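{- Let $G$ be a finite simple graph and let $X$ be a maximal (with respect to inclusion) critical independent set of $G$. Then $\operatorname{diadem}(G) \subseteq (X \cup N(X)) \setminus N(\ker(G))$.
   Context: For $A \subseteq V(G)$, $N(A)$ is the set of vertices adjacent to some vertex of $A$; $d(A)=|A|-|N(A)|$; $d_c(G)=\max\{d(A): A \subseteq V(G)\}$; a set $A$ is critical if $d(A)=d_c(G)$; $\ker(G)$ is the intersection of all critical sets of $G$; $\operatorname{diadem}(G)$ is the union of all critical independent sets of $G$. -}

module Defs where

open import Data.Nat using (ℕ; zero; suc)
open import Data.Bool using (Bool; true; false; _∧_; _∨_)
open import Data.Fin using (Fin; zero; suc)
open import Data.Fin.Subset using (Subset; _∈_; _⊆_; ∣_∣)
open import Data.Vec using (tabulate; lookup)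
open import Data.Integer using (ℤ; _-_; _≤_; +_)
open import Data.Product using (Σ; _×_)
open import Relation.Binary.PropositionalEquality using (_≡_)

record SimpleGraph (n : ℕ) : Set where
  field
    adj      : Fin n → Fin n → Bool
    adj-sym  : ∀ u v → adj u v ≡ adj v u
    loopless : ∀ v → adj v v ≡ false

anyFin : ∀ {n} → (Fin n → Bool) → Bool
anyFin {zero}  f = false
anyFin {suc n} f = f zero ∨ anyFin (λ i → f (suc i))

module _ {n : ℕ} (G : SimpleGraph n) where
  open SimpleGraph G

  Adj : Fin n → Fin n → Set
  Adj u v = adj u v ≡ true

  N : Subset n → Subset n
  N A = tabulate (λ v → anyFin (λ u → lookup A u ∧ adj u v))

  d : Subset n → ℤ
  d A = + ∣ A ∣ - + ∣ N A ∣

  Critical : Subset n → Set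
  Critical A = ∀ (B : Subset n) → d B ≤ d A

  Independent : Subset n → Set
  Independent A = ∀ u v → u ∈ A → v ∈ A → adj u v ≡ false

  CriticalIndependent : Subset n → Set
  CriticalIndependent A = Critical A × Independent A

  MaximalCriticalIndependent : Subset n → Set
  MaximalCriticalIndependent X =
    CriticalIndependent X × (∀ Y → CriticalIndependent Y → X ⊆ Y → Y ⊆ X)

  InKer : Fin n → Set
  InKer v = ∀ (A : Subset n) → Critical A → v ∈ A

  InDiadem : Fin n → Set
  InDiadem v = Σ (Subset n) (λ A → CriticalIndependent A × v ∈ A)

  InNKer : Fin n → Set
  InNKer v = Σ (Fin n) (λ u → InKer u × Adj u v)

-- Supermodularity of d makes X ∪ A critical for every critical A. Deleting N(X) from
-- any set W does not lower d when X is critical: the deleted part S = W ∩ N(X) obeys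
-- the Hall-type bound |S| ≤ |X ∩ N(S)|, and X ∩ N(S) is a part of N(W) that W ─ N(X)
-- does not reach. So (X ∪ A) ─ N(X) is critical; it is independent and contains X,
-- hence equals X by maximality, which gives A ⊆ X ∪ N(X). For the other half, ker(G) ⊆ A,
-- so a neighbour of ker(G) inside A would contradict the independence of A.
module Submission where

open import Defs
open import Data.Bool using (Bool; true; false; _∧_; _∨_)
open import Data.Nat as ℕ using (ℕ; zero; suc; _+_)
import Data.Nat.Properties as ℕ
import Data.Integer as ℤ
import Data.Integer.Properties as ℤ
open import Data.Fin using (Fin; zero; suc)
open import Data.Fin.Subset using (Subset; _∈_; _∉_; _⊆_; _∪_; _∩_; _─_; ∣_∣; Empty; ⊥)
open import Data.Fin.Subset.Properties
  using (_∈?_; p⊆q⇒∣p∣≤∣q∣; x∈p∪q⁺; x∈p∪q⁻; x∈p∩q⁺; x∈p∩q⁻; p∩q⊆p; p∩q⊆q; p⊆p∪q; q⊆p∪q;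
         p─q⊆p; x∈p∧x∉q⇒x∈p─q; Empty-unique; ∣⊥∣≡0)
open import Data.Vec using ([]; _∷_; here; there; lookup; tabulate)
open import Data.Vec.Properties using (lookup∘tabulate; []=⇒lookup; lookup⇒[]=)
open import Data.Product using (_×_; _,_; ∃-syntax)
open import Data.Sum as Sum using (_⊎_; inj₁; inj₂; [_,_]′)
open import Relation.Nullary using (¬_; yes; no; contradiction)
open import Relation.Binary.PropositionalEquality

private
  variable
    n : ℕ

anyFin⁺ : {f : Fin n → Bool} (i : Fin n) → f i ≡ true → anyFin f ≡ true
anyFin⁺ {f = f} zero fi = cong (_∨ anyFin (λ i → f (suc i))) fi
anyFin⁺ {f = f} (suc i) fi with f zero
... | true  = refl
... | false = anyFin⁺ i fi

anyFin⁻ : (f : Fin n → Bool) → anyFin f ≡ true → ∃[ i ] f i ≡ true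
anyFin⁻ {suc n} f eq with f zero in f0
... | true  = zero , f0
... | false with anyFin⁻ (λ i → f (suc i)) eq
...   | i , fi = suc i , fi

∣p∪q∣+∣p∩q∣≡∣p∣+∣q∣ : (p q : Subset n) → ∣ p ∪ q ∣ + ∣ p ∩ q ∣ ≡ ∣ p ∣ + ∣ q ∣
∣p∪q∣+∣p∩q∣≡∣p∣+∣q∣ []          []          = refl
∣p∪q∣+∣p∩q∣≡∣p∣+∣q∣ (true  ∷ p) (true  ∷ q) = cong suc (begin
  ∣ p ∪ q ∣ + suc ∣ p ∩ q ∣ ≡⟨ ℕ.+-suc _ _ ⟩
  suc (∣ p ∪ q ∣ + ∣ p ∩ q ∣) ≡⟨ cong suc (∣p∪q∣+∣p∩q∣≡∣p∣+∣q∣ p q) ⟩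
  suc (∣ p ∣ + ∣ q ∣) ≡⟨ ℕ.+-suc _ _ ⟨
  ∣ p ∣ + suc ∣ q ∣ ∎)
  where open ≡-Reasoning
∣p∪q∣+∣p∩q∣≡∣p∣+∣q∣ (true  ∷ p) (false ∷ q) = cong suc (∣p∪q∣+∣p∩q∣≡∣p∣+∣q∣ p q)
∣p∪q∣+∣p∩q∣≡∣p∣+∣q∣ (false ∷ p) (true  ∷ q) =
  trans (cong suc (∣p∪q∣+∣p∩q∣≡∣p∣+∣q∣ p q)) (sym (ℕ.+-suc _ _))
∣p∪q∣+∣p∩q∣≡∣p∣+∣q∣ (false ∷ p) (false ∷ q) = ∣p∪q∣+∣p∩q∣≡∣p∣+∣q∣ p q

∣p∩q∣+∣p─q∣≡∣p∣ : (p q : Subset n) → ∣ p ∩ q ∣ + ∣ p ─ q ∣ ≡ ∣ p ∣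
∣p∩q∣+∣p─q∣≡∣p∣ []          []          = refl
∣p∩q∣+∣p─q∣≡∣p∣ (true  ∷ p) (true  ∷ q) = cong suc (∣p∩q∣+∣p─q∣≡∣p∣ p q)
∣p∩q∣+∣p─q∣≡∣p∣ (true  ∷ p) (false ∷ q) =
  trans (ℕ.+-suc _ _) (cong suc (∣p∩q∣+∣p─q∣≡∣p∣ p q))
∣p∩q∣+∣p─q∣≡∣p∣ (false ∷ p) (true  ∷ q) = ∣p∩q∣+∣p─q∣≡∣p∣ p q
∣p∩q∣+∣p─q∣≡∣p∣ (false ∷ p) (false ∷ q) = ∣p∩q∣+∣p─q∣≡∣p∣ p q

disjoint⇒∣p∪q∣≡∣p∣+∣q∣ : (p q : Subset n) → Empty (p ∩ q) → ∣ p ∪ q ∣ ≡ ∣ p ∣ + ∣ q ∣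
disjoint⇒∣p∪q∣≡∣p∣+∣q∣ {n} p q p∩q-empty = begin
  ∣ p ∪ q ∣                 ≡⟨ ℕ.+-identityʳ _ ⟨
  ∣ p ∪ q ∣ + 0             ≡⟨ cong (λ k → ∣ p ∪ q ∣ + k) (∣⊥∣≡0 n) ⟨
  ∣ p ∪ q ∣ + ∣ ⊥ {n = n} ∣ ≡⟨ cong (λ r → ∣ p ∪ q ∣ + ∣ r ∣) (Empty-unique p∩q-empty) ⟨
  ∣ p ∪ q ∣ + ∣ p ∩ q ∣     ≡⟨ ∣p∪q∣+∣p∩q∣≡∣p∣+∣q∣ p q ⟩
  ∣ p ∣ + ∣ q ∣             ∎
  where open ≡-Reasoning

disjoint-⊆⇒∣p∣+∣q∣≤∣r∣ : {p q r : Subset n} → Empty (p ∩ q) → p ⊆ r → q ⊆ r →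
                         ∣ p ∣ + ∣ q ∣ ℕ.≤ ∣ r ∣
disjoint-⊆⇒∣p∣+∣q∣≤∣r∣ {p = p} {q} p∩q-empty p⊆r q⊆r =
  subst (ℕ._≤ _) (disjoint⇒∣p∪q∣≡∣p∣+∣q∣ p q p∩q-empty)
    (p⊆q⇒∣p∣≤∣q∣ λ x∈p∪q → [ p⊆r , q⊆r ]′ (x∈p∪q⁻ p q x∈p∪q))

x∈p─q⇒x∉q : (p q : Subset n) {x : Fin n} → x ∈ p ─ q → x ∉ q
x∈p─q⇒x∉q (true  ∷ p) (false ∷ q) here      = λ ()
x∈p─q⇒x∉q (_     ∷ p) (true  ∷ q) (there x∈p─q) (there x∈q) = x∈p─q⇒x∉q p q x∈p─q x∈q
x∈p─q⇒x∉q (_     ∷ p) (false ∷ q) (there x∈p─q) (there x∈q) = x∈p─q⇒x∉q p q x∈p─q x∈q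

Empty[p─q∩q] : (p q : Subset n) → Empty ((p ─ q) ∩ q)
Empty[p─q∩q] p q (x , x∈[p─q]∩q) =
  let x∈p─q , x∈q = x∈p∩q⁻ (p ─ q) q x∈[p─q]∩q in x∈p─q⇒x∉q p q x∈p─q x∈q

-- The prefix +_ of ℤ is kept out of the top-level scope: next to ∣_∣ it makes
-- ∣ p ∣ + ∣ q ∣ ambiguous.
module _ where
  open import Data.Integer using (+_; _-_; -_; _≤_)
  open import Data.Integer.Tactic.RingSolver using (solve-∀)

  +-cancelʳ-≤ : ∀ {i j} k → i ℤ.+ k ≤ j ℤ.+ k → i ≤ j
  +-cancelʳ-≤ {i} {j} k i+k≤j+k =
    subst₂ _≤_ (+k-k i k) (+k-k j k) (ℤ.+-monoˡ-≤ (- k) i+k≤j+k)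
    where
    +k-k : ∀ i k → i ℤ.+ k - k ≡ i
    +k-k = solve-∀

  [+m]-[+n]≤[+o]-[+p] : ∀ {m n o p} → m ℕ.≤ o → p ℕ.≤ n → + m - + n ≤ + o - + p
  [+m]-[+n]≤[+o]-[+p] m≤o p≤n = ℤ.+-mono-≤ (ℤ.+≤+ m≤o) (ℤ.neg-mono-≤ (ℤ.+≤+ p≤n))

  [+m-+n]+[+o-+p]≡[+m+o]-[+n+p] : ∀ m n o p →
    (+ m - + n) ℤ.+ (+ o - + p) ≡ + (m + o) - + (n + p)
  [+m-+n]+[+o-+p]≡[+m+o]-[+n+p] m n o p = trans
    (regroup (+ m) (+ n) (+ o) (+ p))
    (sym (cong₂ _-_ (ℤ.pos-+ m o) (ℤ.pos-+ n p)))
    where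
    regroup : ∀ a b c e → (a - b) ℤ.+ (c - e) ≡ (a ℤ.+ c) - (b ℤ.+ e)
    regroup = solve-∀

  [+k+m]-[+k+n]≡[+m]-[+n] : ∀ k m n → + (k + m) - + (k + n) ≡ + m - + n
  [+k+m]-[+k+n]≡[+m]-[+n] k m n = begin
    + (k + m) - + (k + n) ≡⟨ ℤ.[+m]-[+n]≡m⊖n (k + m) (k + n) ⟩
    (k + m) ℤ.⊖ (k + n)   ≡⟨ ℤ.+-cancelˡ-⊖ k m n ⟩
    m ℤ.⊖ n               ≡⟨ ℤ.[+m]-[+n]≡m⊖n m n ⟨
    + m - + n             ∎
    where open ≡-Reasoning

  [+m]-[+n]≤[+o]-[+p]⇒m+p≤o+n : ∀ {m n o p} → + m - + n ≤ + o - + p → m + p ℕ.≤ o + n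
  [+m]-[+n]≤[+o]-[+p]⇒m+p≤o+n {m} {n} {o} {p} m-n≤o-p = ℤ.drop‿+≤+ (subst₂ _≤_
    (trans (shift (+ m) (+ n) (+ p)) (sym (ℤ.pos-+ m p)))
    (trans (shift′ (+ o) (+ n) (+ p)) (sym (ℤ.pos-+ o n)))
    (ℤ.+-monoˡ-≤ (+ n ℤ.+ + p) m-n≤o-p))
    where
    shift : ∀ a b c → (a - b) ℤ.+ (b ℤ.+ c) ≡ a ℤ.+ c
    shift = solve-∀
    shift′ : ∀ a b c → (a - c) ℤ.+ (b ℤ.+ c) ≡ a ℤ.+ b
    shift′ = solve-∀

module _ (G : SimpleGraph n) where
  open SimpleGraph G

  private
    variable
      A B X : Subset n
      u v : Fin n

  Adj-sym : Adj G u v → Adj G v u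
  Adj-sym {u} {v} u~v = trans (adj-sym v u) u~v

  ∈N⁺ : u ∈ A → Adj G u v → v ∈ N G A
  ∈N⁺ {u} {A} {v} u∈A u~v = lookup⇒[]= v (N G A)
    (trans (lookup∘tabulate _ v) (anyFin⁺ u (cong₂ _∧_ ([]=⇒lookup u∈A) u~v)))

  ∈N⁻ : v ∈ N G A → ∃[ u ] u ∈ A × Adj G u v
  ∈N⁻ {v} {A} v∈NA
    with anyFin⁻ _ (trans (sym (lookup∘tabulate _ v)) ([]=⇒lookup v∈NA))
  ... | u , Au∧u~v with lookup A u in Au
  ...   | true = u , lookup⇒[]= u A Au , Au∧u~v

  N-mono : A ⊆ B → N G A ⊆ N G B
  N-mono A⊆B v∈NA with ∈N⁻ v∈NA
  ... | u , u∈A , u~v = ∈N⁺ (A⊆B u∈A) u~v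

  N-∪ : N G (A ∪ B) ⊆ N G A ∪ N G B
  N-∪ {A} {B} v∈N[A∪B] with ∈N⁻ v∈N[A∪B]
  ... | u , u∈A∪B , u~v = x∈p∪q⁺ (Sum.map (λ u∈A → ∈N⁺ u∈A u~v) (λ u∈B → ∈N⁺ u∈B u~v)
                                    (x∈p∪q⁻ A B u∈A∪B))

  N-∩ : N G (A ∩ B) ⊆ N G A ∩ N G B
  N-∩ {A} {B} v∈N[A∩B] =
    x∈p∩q⁺ (N-mono (p∩q⊆p A B) v∈N[A∩B] , N-mono (p∩q⊆q A B) v∈N[A∩B])

  disjoint-N-sym : Empty (A ∩ N G B) → Empty (N G A ∩ B)
  disjoint-N-sym {A} {B} A∩NB-empty (v , v∈NA∩B) with x∈p∩q⁻ (N G A) B v∈NA∩B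
  ... | v∈NA , v∈B with ∈N⁻ v∈NA
  ...   | u , u∈A , u~v = A∩NB-empty (u , x∈p∩q⁺ (u∈A , ∈N⁺ v∈B (Adj-sym u~v)))

  ∉N⇒nonadjacent : u ∈ A → v ∉ N G A → adj u v ≡ false
  ∉N⇒nonadjacent {u} {A} {v} u∈A v∉NA with adj u v in u~v
  ... | false = refl
  ... | true  = contradiction (∈N⁺ u∈A u~v) v∉NA

  Independent⇒∉N : Independent G A → v ∈ A → v ∉ N G A
  Independent⇒∉N {A} {v} indA v∈A v∈NA with ∈N⁻ v∈NA
  ... | u , u∈A , u~v = contradiction (trans (sym (indA u v u∈A v∈A)) u~v) λ ()

  Independent-∪─N : Independent G X → Independent G A → Independent G ((X ∪ A) ─ N G X)
  Independent-∪─N {X} {A} indX indA u v u∈T v∈T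
    with x∈p∪q⁻ X A (p─q⊆p _ _ u∈T) | x∈p∪q⁻ X A (p─q⊆p _ _ v∈T)
  ... | inj₁ u∈X | inj₁ v∈X = indX u v u∈X v∈X
  ... | inj₂ u∈A | inj₂ v∈A = indA u v u∈A v∈A
  ... | inj₁ u∈X | inj₂ _   = ∉N⇒nonadjacent u∈X (x∈p─q⇒x∉q _ _ v∈T)
  ... | inj₂ _   | inj₁ v∈X = trans (adj-sym u v) (∉N⇒nonadjacent v∈X (x∈p─q⇒x∉q _ _ u∈T))

  d-supermodular : ∀ A B → d G A ℤ.+ d G B ℤ.≤ d G (A ∪ B) ℤ.+ d G (A ∩ B)
  d-supermodular A B = subst₂ ℤ._≤_
    (sym ([+m-+n]+[+o-+p]≡[+m+o]-[+n+p] (∣ A ∣) (∣ N G A ∣) (∣ B ∣) (∣ N G B ∣)))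
    (sym ([+m-+n]+[+o-+p]≡[+m+o]-[+n+p] (∣ A ∪ B ∣) (∣ N G (A ∪ B) ∣) (∣ A ∩ B ∣) (∣ N G (A ∩ B) ∣)))
    ([+m]-[+n]≤[+o]-[+p] (ℕ.≤-reflexive (sym (∣p∪q∣+∣p∩q∣≡∣p∣+∣q∣ A B))) neighbours)
    where
    neighbours : ∣ N G (A ∪ B) ∣ + ∣ N G (A ∩ B) ∣ ℕ.≤ ∣ N G A ∣ + ∣ N G B ∣
    neighbours = ℕ.≤-trans (ℕ.+-mono-≤ (p⊆q⇒∣p∣≤∣q∣ (N-∪ {A} {B})) (p⊆q⇒∣p∣≤∣q∣ (N-∩ {A} {B})))
                           (ℕ.≤-reflexive (∣p∪q∣+∣p∩q∣≡∣p∣+∣q∣ (N G A) (N G B)))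

  d≤d⇒∣A∣+∣N[B]∣≤∣B∣+∣N[A]∣ : ∀ A B → d G A ℤ.≤ d G B → ∣ A ∣ + ∣ N G B ∣ ℕ.≤ ∣ B ∣ + ∣ N G A ∣
  d≤d⇒∣A∣+∣N[B]∣≤∣B∣+∣N[A]∣ A B =
    [+m]-[+n]≤[+o]-[+p]⇒m+p≤o+n {∣ A ∣} {∣ N G A ∣} {∣ B ∣} {∣ N G B ∣}

  Critical-∪ : ∀ A B → Critical G A → Critical G B → Critical G (A ∪ B)
  Critical-∪ A B critA critB C = ℤ.≤-trans (critA C) (+-cancelʳ-≤ (d G B)
    (ℤ.≤-trans (d-supermodular A B) (ℤ.+-monoʳ-≤ (d G (A ∪ B)) (critB (A ∩ B)))))

  Critical⇒∣S∣≤∣X∩N[S]∣ : ∀ X {S} → Critical G X → S ⊆ N G X → ∣ S ∣ ℕ.≤ ∣ X ∩ N G S ∣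
  Critical⇒∣S∣≤∣X∩N[S]∣ X {S} critX S⊆NX = ℕ.+-cancelʳ-≤ (∣ N G Q ∣ + ∣ Q ∣) _ _ (begin
    ∣ S ∣ + (∣ N G Q ∣ + ∣ Q ∣)         ≡⟨ +-rotate (∣ S ∣) (∣ N G Q ∣) (∣ Q ∣) ⟩
    ∣ N G Q ∣ + ∣ S ∣ + ∣ Q ∣           ≤⟨ ℕ.+-monoˡ-≤ ∣ Q ∣ NQ+S≤NX ⟩
    ∣ N G X ∣ + ∣ Q ∣                   ≡⟨ ℕ.+-comm (∣ N G X ∣) (∣ Q ∣) ⟩
    ∣ Q ∣ + ∣ N G X ∣                   ≤⟨ d≤d⇒∣A∣+∣N[B]∣≤∣B∣+∣N[A]∣ Q X (critX Q) ⟩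
    ∣ X ∣ + ∣ N G Q ∣                   ≡⟨ cong (_+ ∣ N G Q ∣) (∣p∩q∣+∣p─q∣≡∣p∣ X (N G S)) ⟨
    ∣ X ∩ N G S ∣ + ∣ Q ∣ + ∣ N G Q ∣   ≡⟨ +-rotate′ (∣ X ∩ N G S ∣) (∣ Q ∣) (∣ N G Q ∣) ⟩
    ∣ X ∩ N G S ∣ + (∣ N G Q ∣ + ∣ Q ∣) ∎)
    where
    open ℕ.≤-Reasoning
    open import Data.Nat.Tactic.RingSolver using (solve-∀)
    +-rotate : ∀ a b c → a + (b + c) ≡ b + a + c
    +-rotate = solve-∀
    +-rotate′ : ∀ a b c → a + b + c ≡ a + (c + b)
    +-rotate′ = solve-∀
    Q : Subset n
    Q = X ─ N G S
    NQ+S≤NX : ∣ N G Q ∣ + ∣ S ∣ ℕ.≤ ∣ N G X ∣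
    NQ+S≤NX = disjoint-⊆⇒∣p∣+∣q∣≤∣r∣
      (disjoint-N-sym (Empty[p─q∩q] X (N G S)))
      (N-mono (p─q⊆p X (N G S))) S⊆NX

  Critical⇒d≤d[W─N[X]] : ∀ X → Critical G X → ∀ W → d G W ℤ.≤ d G (W ─ N G X)
  Critical⇒d≤d[W─N[X]] X critX W = ℤ.≤-trans
    ([+m]-[+n]≤[+o]-[+p] (ℕ.≤-reflexive (sym (∣p∩q∣+∣p─q∣≡∣p∣ W (N G X)))) S+NT≤NW)
    (ℤ.≤-reflexive ([+k+m]-[+k+n]≡[+m]-[+n] (∣ S ∣) (∣ T ∣) (∣ N G T ∣)))
    where
    S T : Subset n
    S = W ∩ N G X
    T = W ─ N G X
    NT∩X-empty : Empty (N G T ∩ X)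
    NT∩X-empty = disjoint-N-sym (Empty[p─q∩q] W (N G X))
    NT+X∩NS≤NW : ∣ N G T ∣ + ∣ X ∩ N G S ∣ ℕ.≤ ∣ N G W ∣
    NT+X∩NS≤NW = disjoint-⊆⇒∣p∣+∣q∣≤∣r∣
      (λ (u , u∈NT∩X∩NS) → let u∈NT , u∈X∩NS = x∈p∩q⁻ (N G T) _ u∈NT∩X∩NS
                           in NT∩X-empty (u , x∈p∩q⁺ (u∈NT , p∩q⊆p X (N G S) u∈X∩NS)))
      (N-mono (p─q⊆p W (N G X)))
      (λ u∈X∩NS → N-mono (p∩q⊆p W (N G X)) (p∩q⊆q X (N G S) u∈X∩NS))
    S+NT≤NW : ∣ S ∣ + ∣ N G T ∣ ℕ.≤ ∣ N G W ∣
    S+NT≤NW = begin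
      ∣ S ∣ + ∣ N G T ∣             ≤⟨ ℕ.+-monoˡ-≤ ∣ N G T ∣ (Critical⇒∣S∣≤∣X∩N[S]∣ X critX (p∩q⊆q W (N G X))) ⟩
      ∣ X ∩ N G S ∣ + ∣ N G T ∣     ≡⟨ ℕ.+-comm (∣ X ∩ N G S ∣) (∣ N G T ∣) ⟩
      ∣ N G T ∣ + ∣ X ∩ N G S ∣     ≤⟨ NT+X∩NS≤NW ⟩
      ∣ N G W ∣                     ∎
      where open ℕ.≤-Reasoning

  MaximalCriticalIndependent⇒⊆∪N : MaximalCriticalIndependent G X → CriticalIndependent G A →
                                   A ⊆ X ∪ N G X
  MaximalCriticalIndependent⇒⊆∪N {X} {A} ((critX , indX) , maximal) (critA , indA) {v} v∈A
    with v ∈? N G X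
  ... | yes v∈NX = q⊆p∪q X (N G X) v∈NX
  ... | no  v∉NX = p⊆p∪q (N G X) (maximal T (critT , indT) X⊆T v∈T)
    where
    T : Subset n
    T = (X ∪ A) ─ N G X
    critT : Critical G T
    critT B = ℤ.≤-trans (Critical-∪ X A critX critA B) (Critical⇒d≤d[W─N[X]] X critX (X ∪ A))
    indT : Independent G T
    indT = Independent-∪─N indX indA
    X⊆T : X ⊆ T
    X⊆T x∈X = x∈p∧x∉q⇒x∈p─q (p⊆p∪q A x∈X) (Independent⇒∉N indX x∈X)
    v∈T : v ∈ T
    v∈T = x∈p∧x∉q⇒x∈p─q (q⊆p∪q X A v∈A) v∉NX

  CriticalIndependent⇒¬InNKer : CriticalIndependent G A → v ∈ A → ¬ InNKer G v
  CriticalIndependent⇒¬InNKer {A} {v} (critA , indA) v∈A (u , u∈ker , u~v) =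
    contradiction (trans (sym (indA u v (u∈ker A critA) v∈A)) u~v) λ ()

theorem3p2 : ∀ {n : ℕ} (G : SimpleGraph n) (X : Subset n) →
    MaximalCriticalIndependent G X →
    ∀ (v : Fin n) → InDiadem G v →
      (v ∈ X ⊎ v ∈ N G X) × ¬ InNKer G v
theorem3p2 G X maximalX v (A , critIndA , v∈A) =
  x∈p∪q⁻ X (N G X) (MaximalCriticalIndependent⇒⊆∪N G maximalX critIndA v∈A) ,
  CriticalIndependent⇒¬InNKer G critIndA v∈A
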